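{- For all integers $n\ge 1$, we have $\mathbb{N}^\varphi(n)\in\{1,2,4,6\}$, where $\mathbb{N}^\varphi(n)=\varphi(1+\varphi(2+\varphi(3+\cdots+\varphi(n)\cdots)))$.
   Context: $\varphi$ denotes Euler's totient function. Precisely, define $x_n=0$ and $x_{k-1}=\varphi(k+x_k)$ for $k=n,n-1,\dots,1$; then $\mathbb{N}^\varphi(n)=x_0$. -}

module Defs where

open import Data.Nat using (ℕ; zero; suc; _+_)
open import Data.Nat.GCD using (gcd)
open import Data.List using (List; length; filter)
open import Data.List.Base using (upTo)
open import Data.Nat using (_≟_)
open import Data.Nat.Coprimality using (Coprime)

-- Euler's totient: φ n = #{ k ∈ {1,…,n} : gcd k n = 1 }  (so φ 0 = 0, φ 1 = 1)
φ : ℕ → ℕ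
φ n = length (filter (λ k → gcd (suc k) n ≟ 1) (upTo n))

-- nestφ m k : with n = k + m - 1, x_n = 0 and x_{j-1} = φ (j + x_j),
-- nestφ m k computes x_{k-1}  (m = number of remaining φ-applications).
nestφ : ℕ → ℕ → ℕ
nestφ zero    k = 0
nestφ (suc m) k = φ (k + nestφ m (suc k))

Nφ : ℕ → ℕ
Nφ n = nestφ n 1

{-# OPTIONS --safe #-}
module Submission where

-- For m ≥ 3 the residues coprime to m pair up under a ↦ m − a (for even m the fixed point m/2
-- is not coprime to m), so φ m is even; and φ (2t) ≤ t since no even residue is coprime to 2t.
-- With x_{k-1} = φ (k + x_k), two steps of the recursion use these facts, halving the argument
-- k + 1 + x_{k+1} when k is odd and k + x_k when k is even, to show that an even
-- x_{k+1} ≤ 6(k + 2) gives x_{k-1} ≤ 6k once k ≥ 5. Hence x_4 is an even number ≤ 30, and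
-- N^φ(n) = φ (1 + φ (2 + φ (3 + φ (4 + x_4)))) is checked by evaluation for those 16 values.

open import Defs
open import Data.Nat using (ℕ; _≥_)
open import Data.Sum using (_⊎_)
open import Relation.Binary.PropositionalEquality using (_≡_)

open import Data.List using ([_]; _++_; length; filter; upTo)
open import Data.List.Properties using (upTo-∷ʳ; filter-++; length-++)
open import Data.Nat using (zero; suc; _+_; _*_; _≤_; _<_; _≟_; z≤n; s≤s)
open import Data.Nat.Divisibility using (_∣_; ∣-refl; ∣-trans; ∣1⇒≡1; ∣m+n∣m⇒∣n; ∣m∣n⇒∣m+n; m∣m*n)
open import Data.Nat.GCD using (gcd; gcd[m,n]∣m; gcd[m,n]∣n; gcd-greatest; gcd-universality)
open import Data.Nat.Properties
  using (≤-refl; ≤-trans; m≤m+n; m≤n+m; m≤n⇒m≤1+n; ≤-pred; +-identityʳ; +-suc; +-comm; +-assoc; +-mono-≤; +-monoʳ-≤; >⇒≢; allUpTo?; module ≤-Reasoning)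
open import Data.Nat.Tactic.RingSolver using (solve-∀)
open import Data.Product using (∃; _×_; _,_)
open import Data.Sum using (inj₁; inj₂)
open import Relation.Nullary using (Dec; contradiction)
open import Relation.Nullary.Decidable using (_⊎-dec_; toWitness)
open import Relation.Binary.PropositionalEquality using (_≢_; refl; sym; trans; cong; cong₂; subst; module ≡-Reasoning)

δ₁ : ℕ → ℕ
δ₁ 1 = 1
δ₁ _ = 0

coprimeTo : ℕ → ℕ → ℕ
coprimeTo m a = δ₁ (gcd a m)

coprimesUpTo : ℕ → ℕ → ℕ
coprimesUpTo m zero    = 0
coprimesUpTo m (suc j) = coprimesUpTo m j + coprimeTo m (suc j)

length-filter-coprime-upTo : ∀ m j →
  length (filter (λ k → gcd (suc k) m ≟ 1) (upTo j)) ≡ coprimesUpTo m j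
length-filter-coprime-upTo m zero    = refl
length-filter-coprime-upTo m (suc j) = begin
  length (filter P? (upTo (suc j)))
    ≡⟨ cong (λ l → length (filter P? l)) (sym (upTo-∷ʳ j)) ⟩
  length (filter P? (upTo j ++ [ j ]))
    ≡⟨ cong length (filter-++ P? (upTo j) [ j ]) ⟩
  length (filter P? (upTo j) ++ filter P? [ j ])
    ≡⟨ length-++ (filter P? (upTo j)) ⟩
  length (filter P? (upTo j)) + length (filter P? [ j ])
    ≡⟨ cong₂ _+_ (length-filter-coprime-upTo m j) last ⟩
  coprimesUpTo m j + coprimeTo m (suc j)
    ∎
  where
  open ≡-Reasoning
  P? = λ k → gcd (suc k) m ≟ 1
  last : length (filter P? [ j ]) ≡ coprimeTo m (suc j)
  last with gcd (suc j) m
  ... | 0           = refl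
  ... | 1           = refl
  ... | suc (suc _) = refl

φ≡coprimesUpTo : ∀ m → φ m ≡ coprimesUpTo m m
φ≡coprimesUpTo m = length-filter-coprime-upTo m m

coprimeTo≤1 : ∀ m a → coprimeTo m a ≤ 1
coprimeTo≤1 m a with gcd a m
... | 0           = z≤n
... | 1           = ≤-refl
... | suc (suc _) = z≤n

coprimeTo-commonDivisor : ∀ {m a d} → d ∣ a → d ∣ m → d ≢ 1 → coprimeTo m a ≡ 0
coprimeTo-commonDivisor {m} {a} d∣a d∣m d≢1 with gcd a m | gcd-greatest d∣a d∣m
... | 0           | _   = refl
... | 1           | d∣1 = contradiction (∣1⇒≡1 d∣1) d≢1
... | suc (suc _) | _   = refl

coprimeTo-self : ∀ {m} → 2 ≤ m → coprimeTo m m ≡ 0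
coprimeTo-self 2≤m = coprimeTo-commonDivisor ∣-refl ∣-refl (>⇒≢ 2≤m)

coprimesUpTo≤ : ∀ m j → coprimesUpTo m j ≤ j
coprimesUpTo≤ m zero    = z≤n
coprimesUpTo≤ m (suc j) =
  subst (coprimesUpTo m (suc j) ≤_) (+-comm j 1) (+-mono-≤ (coprimesUpTo≤ m j) (coprimeTo≤1 m (suc j)))

φ[m]≤m : ∀ m → φ m ≤ m
φ[m]≤m m = subst (_≤ m) (sym (φ≡coprimesUpTo m)) (coprimesUpTo≤ m m)

gcd-complement : ∀ {a b m} → a + b ≡ m → gcd a m ≡ gcd b m
gcd-complement {a} {b} refl = gcd-universality forwards backwards
  where
  forwards : ∀ {d} → d ∣ b × d ∣ a + b → d ∣ gcd a (a + b)
  forwards {d} (d∣b , d∣a+b) = gcd-greatest (∣m+n∣m⇒∣n (subst (d ∣_) (+-comm a b) d∣a+b) d∣b) d∣a+b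
  backwards : ∀ {d} → d ∣ gcd a (a + b) → d ∣ b × d ∣ a + b
  backwards d∣gcd = ∣m+n∣m⇒∣n d∣a+b (∣-trans d∣gcd (gcd[m,n]∣m a (a + b))) , d∣a+b
    where d∣a+b = ∣-trans d∣gcd (gcd[m,n]∣n a (a + b))

coprimeTo-complement : ∀ a b {m} → a + b ≡ m → coprimeTo m a ≡ coprimeTo m b
coprimeTo-complement a b a+b≡m = cong δ₁ (gcd-complement {a} {b} a+b≡m)

coprimesUpTo-split : ∀ {M} i j → i + j ≡ M →
  coprimesUpTo (suc M) M ≡ coprimesUpTo (suc M) i + coprimesUpTo (suc M) j
coprimesUpTo-split i zero refl rewrite +-identityʳ i = sym (+-identityʳ _)
coprimesUpTo-split {M} i (suc j) i+1+j≡M = begin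
  S M                                ≡⟨ coprimesUpTo-split (suc i) j (trans (sym (+-suc i j)) i+1+j≡M) ⟩
  S i + coprimeTo m (suc i) + S j    ≡⟨ cong (λ c → S i + c + S j) (coprimeTo-complement (suc i) (suc j) (cong suc i+1+j≡M)) ⟩
  S i + coprimeTo m (suc j) + S j    ≡⟨ +-assoc (S i) _ (S j) ⟩
  S i + (coprimeTo m (suc j) + S j)  ≡⟨ cong (S i +_) (+-comm _ (S j)) ⟩
  S i + S (suc j)                    ∎
  where
  open ≡-Reasoning
  m = suc M
  S = coprimesUpTo m

Even : ℕ → Set
Even n = ∃ λ h → n ≡ h + h

data ParityView : ℕ → Set where
  even : ∀ h → ParityView (h + h)
  odd  : ∀ h → ParityView (suc (h + h))

parityView : ∀ n → ParityView n
parityView zero    = even 0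
parityView (suc n) with parityView n
... | even h = odd h
... | odd h  = subst ParityView (cong suc (+-suc h h)) (even (suc h))

n∣n+n : ∀ n → n ∣ n + n
n∣n+n n = ∣m∣n⇒∣m+n ∣-refl ∣-refl

coprimesUpTo-pred-even : ∀ {M} → ParityView M → 2 ≤ M → Even (coprimesUpTo (suc M) M)
coprimesUpTo-pred-even (even h)      _        = coprimesUpTo _ h , coprimesUpTo-split h h refl
coprimesUpTo-pred-even (odd zero)    (s≤s ())
coprimesUpTo-pred-even (odd (suc h)) _        = S (suc h) , (begin
  S M                                    ≡⟨ coprimesUpTo-split (suc (suc h)) (suc h) refl ⟩
  S (suc h) + coprimeTo m (2 + h) + S (suc h)
                                         ≡⟨ cong (λ c → S (suc h) + c + S (suc h)) middle≡0 ⟩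
  S (suc h) + 0 + S (suc h)              ≡⟨ cong (_+ S (suc h)) (+-identityʳ (S (suc h))) ⟩
  S (suc h) + S (suc h)                  ∎)
  where
  open ≡-Reasoning
  M = suc (suc h + suc h)
  m = suc M
  S = coprimesUpTo m
  middle≡0 : coprimeTo m (2 + h) ≡ 0
  middle≡0 = coprimeTo-commonDivisor ∣-refl (subst (2 + h ∣_) (cong suc (+-suc (suc h) (suc h))) (n∣n+n (2 + h))) (λ ())

φ-even : ∀ m → 3 ≤ m → Even (φ m)
φ-even (suc M) (s≤s 2≤M) =
  subst Even (sym φ≡) (coprimesUpTo-pred-even (parityView M) 2≤M)
  where
  open ≡-Reasoning
  S = coprimesUpTo (suc M)
  φ≡ : φ (suc M) ≡ S M
  φ≡ = begin
    φ (suc M)                        ≡⟨ φ≡coprimesUpTo (suc M) ⟩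
    S M + coprimeTo (suc M) (suc M)  ≡⟨ cong (S M +_) (coprimeTo-self (m≤n⇒m≤1+n 2≤M)) ⟩
    S M + 0                          ≡⟨ +-identityʳ (S M) ⟩
    S M                              ∎

2∣n+n : ∀ n → 2 ∣ n + n
2∣n+n n = subst (2 ∣_) (cong (n +_) (+-identityʳ n)) (m∣m*n n)

coprimesUpTo-double≤ : ∀ {m} → 2 ∣ m → ∀ j → coprimesUpTo m (j + j) ≤ j
coprimesUpTo-double≤     2∣m zero = z≤n
coprimesUpTo-double≤ {m} 2∣m (suc j) rewrite +-suc j j = begin
  S (j + j) + coprimeTo m (1 + (j + j)) + coprimeTo m (2 + (j + j))
                                           ≡⟨ cong (S (j + j) + coprimeTo m (1 + (j + j)) +_) next≡0 ⟩
  S (j + j) + coprimeTo m (1 + (j + j)) + 0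
                                           ≡⟨ +-identityʳ _ ⟩
  S (j + j) + coprimeTo m (1 + (j + j))    ≤⟨ +-mono-≤ (coprimesUpTo-double≤ 2∣m j) (coprimeTo≤1 m (1 + (j + j))) ⟩
  j + 1                                    ≡⟨ +-comm j 1 ⟩
  suc j                                    ∎
  where
  open ≤-Reasoning
  S = coprimesUpTo m
  next≡0 : coprimeTo m (2 + (j + j)) ≡ 0
  next≡0 = coprimeTo-commonDivisor (∣m∣n⇒∣m+n ∣-refl (2∣n+n j)) 2∣m (λ ())

φ[t+t]≤t : ∀ t → φ (t + t) ≤ t
φ[t+t]≤t t = subst (_≤ t) (sym (φ≡coprimesUpTo (t + t))) (coprimesUpTo-double≤ (2∣n+n t) t)

m+m≤1+n+n⇒m≤n : ∀ {m n} → m + m ≤ suc (n + n) → m ≤ n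
m+m≤1+n+n⇒m≤n {zero}          _             = z≤n
m+m≤1+n+n⇒m≤n {suc m} {zero}  (s≤s 1+m+m≤0) rewrite +-suc m m with () ← 1+m+m≤0
m+m≤1+n+n⇒m≤n {suc m} {suc n} (s≤s le) rewrite +-suc m m | +-suc n n = s≤s (m+m≤1+n+n⇒m≤n (≤-pred le))

≤-witness : ∀ {a b} d → a + d ≡ b → a ≤ b
≤-witness {a} d refl = m≤m+n a d

module TwoSteps (f : ℕ → ℕ)
                (f[m]≤m : ∀ m → f m ≤ m)
                (f[t+t]≤t : ∀ t → f (t + t) ≤ t)
                (f-even : ∀ m → 3 ≤ m → Even (f m)) where

  open ≤-Reasoning

  twoSteps≤ : ∀ {k} → ParityView k → 5 ≤ k → ∀ {y} → Even y → y ≤ 6 * (2 + k) →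
              f (k + f (suc k + y)) ≤ 6 * k
  twoSteps≤ (even 0) () _ _
  twoSteps≤ (even 1) (s≤s (s≤s ())) _ _
  twoSteps≤ (even h@(suc (suc h′))) _ {y} _ y≤
    with f (suc (h + h) + y) | f-even (suc (h + h) + y) (s≤s (s≤s (s≤s z≤n))) | f[m]≤m (suc (h + h) + y)
  ... | .(v + v) | v , refl | v+v≤ = begin
    f (h + h + (v + v))    ≡⟨ cong f (regroup h v) ⟩
    f ((h + v) + (h + v))  ≤⟨ f[t+t]≤t (h + v) ⟩
    h + v                  ≤⟨ +-monoʳ-≤ h v≤ ⟩
    h + (7 * h + 6)        ≤⟨ ≤-witness (2 + 4 * h′) (slack h′) ⟩
    6 * (h + h)            ∎
    where
    regroup : ∀ h v → (h + h) + (v + v) ≡ (h + v) + (h + v)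
    regroup = solve-∀
    halve : ∀ h → (h + h) + 6 * (2 + (h + h)) ≡ (7 * h + 6) + (7 * h + 6)
    halve = solve-∀
    slack : ∀ h′ → (2 + h′) + (7 * (2 + h′) + 6) + (2 + 4 * h′) ≡ 6 * ((2 + h′) + (2 + h′))
    slack = solve-∀
    v≤ : v ≤ 7 * h + 6
    v≤ = m+m≤1+n+n⇒m≤n (≤-trans v+v≤ (s≤s (subst (h + h + y ≤_) (halve h) (+-monoʳ-≤ (h + h) y≤))))
  twoSteps≤ (odd 0) (s≤s ()) _ _
  twoSteps≤ (odd 1) (s≤s (s≤s (s≤s ()))) _ _
  twoSteps≤ (odd h@(suc (suc h′))) _ (u , refl) y≤ = begin
    f (k + z)                     ≤⟨ f[m]≤m (k + z) ⟩
    k + z                         ≤⟨ +-monoʳ-≤ k z≤ ⟩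
    k + (suc h + u)               ≤⟨ +-monoʳ-≤ k (+-monoʳ-≤ (suc h) u≤) ⟩
    k + (suc h + (6 * h + 9))     ≤⟨ ≤-witness (1 + 3 * h′) (slack h′) ⟩
    6 * k                         ∎
    where
    k = suc (h + h)
    z = f (suc k + (u + u))
    regroup : ∀ h u → suc (suc (h + h)) + (u + u) ≡ (suc h + u) + (suc h + u)
    regroup = solve-∀
    halve : ∀ h → 6 * (2 + suc (h + h)) ≡ (6 * h + 9) + (6 * h + 9)
    halve = solve-∀
    slack : ∀ h′ → suc ((2 + h′) + (2 + h′)) + (suc (2 + h′) + (6 * (2 + h′) + 9)) + (1 + 3 * h′)
                   ≡ 6 * suc ((2 + h′) + (2 + h′))
    slack = solve-∀
    z≤ : z ≤ suc h + u
    z≤ = subst (λ x → f x ≤ suc h + u) (sym (regroup h u)) (f[t+t]≤t (suc h + u))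
    u≤ : u ≤ 6 * h + 9
    u≤ = m+m≤1+n+n⇒m≤n (m≤n⇒m≤1+n (subst (u + u ≤_) (halve h) y≤))

open TwoSteps φ φ[m]≤m φ[t+t]≤t φ-even using (twoSteps≤)

nestφ-even : ∀ m k → 3 ≤ k → Even (nestφ m k)
nestφ-even zero    k _   = 0 , refl
nestφ-even (suc m) k 3≤k = φ-even (k + nestφ m (suc k)) (≤-trans 3≤k (m≤m+n k _))

nestφ≤6k : ∀ m k → 5 ≤ k → nestφ m k ≤ 6 * k
nestφ≤6k zero          k _   = z≤n
nestφ≤6k (suc zero)    k _   = ≤-trans (φ[m]≤m (k + 0)) (+-monoʳ-≤ k z≤n)
nestφ≤6k (suc (suc m)) k 5≤k =
  twoSteps≤ (parityView k) 5≤k (nestφ-even m (2 + k) 3≤2+k) (nestφ≤6k m (2 + k) 5≤2+k)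
  where
  5≤2+k = ≤-trans 5≤k (m≤n+m k 2)
  3≤2+k = ≤-trans (s≤s (s≤s (s≤s z≤n))) 5≤2+k

φChain : ℕ → ℕ → ℕ → ℕ
φChain zero    k y = y
φChain (suc n) k y = φ (k + φChain n (suc k) y)

nestφ-split : ∀ n m k → nestφ (n + m) k ≡ φChain n k (nestφ m (n + k))
nestφ-split zero    m k = refl
nestφ-split (suc n) m k rewrite sym (+-suc n k) = cong (λ x → φ (k + x)) (nestφ-split n m (suc k))

In1246 : ℕ → Set
In1246 v = v ≡ 1 ⊎ v ≡ 2 ⊎ v ≡ 4 ⊎ v ≡ 6

in1246? : ∀ v → Dec (In1246 v)
in1246? v = v ≟ 1 ⊎-dec v ≟ 2 ⊎-dec v ≟ 4 ⊎-dec v ≟ 6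

φChain₄-1246 : ∀ y → Even y → y ≤ 30 → In1246 (φChain 4 1 y)
φChain₄-1246 _ (u , refl) u+u≤30 = checked {u} (s≤s (m+m≤1+n+n⇒m≤n (m≤n⇒m≤1+n u+u≤30)))
  where
  -- u is passed explicitly: unifying an implicit u under φChain would make Agda unfold φ.
  checked : ∀ {u} → u < 16 → In1246 (φChain 4 1 (u + u))
  checked = toWitness {a? = allUpTo? (λ u → in1246? (φChain 4 1 (u + u))) 16} _

corollary2p1p2 : (n : ℕ) → n ≥ 1 →
    Nφ n ≡ 1 ⊎ Nφ n ≡ 2 ⊎ Nφ n ≡ 4 ⊎ Nφ n ≡ 6
corollary2p1p2 1 _ = inj₁ refl
corollary2p1p2 2 _ = inj₁ refl
corollary2p1p2 3 _ = inj₂ (inj₁ refl)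
corollary2p1p2 (suc (suc (suc (suc m)))) _ =
  -- 4 + 1 rather than 5, matching nestφ-split, for the same reason as in φChain₄-1246.
  subst In1246 (sym (nestφ-split 4 m 1))
    (φChain₄-1246 (nestφ m (4 + 1)) (nestφ-even m 5 3≤5) (nestφ≤6k m 5 ≤-refl))
  where
  3≤5 : 3 ≤ 5
  3≤5 = s≤s (s≤s (s≤s z≤n))
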